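{- Let $\mathsf{FOL\Box}$ be the system defined in the context. For every formula $A$ of $\mathcal{L}(\forall,\Box)$: if $A\in \mathsf{FOL\Box}$, then $A$ is logically valid, i.e. $\mathcal{A}\models A$ for every universal structure $\mathcal{A}$.
   Context: Language $\mathcal{L}(\forall,\Box)$: first-order language with identity $=$, a set of predicate symbols $P^n_j$ ($n$-ary), variables, no constants or function symbols, connectives $\neg,\to$, quantifier $\forall$, and a modal operator $\Box$ (read "is a thesis"), allowing arbitrary nesting. Other connectives are defined as usual, $\exists x := \neg\forall x\neg$, and $\Diamond := \neg\Box\neg$. A formula is $\Box$-free if it contains no $\Box$. $\mathsf{FOL}$ denotes the set of $\Box$-free formulas that are theses (equivalently, valid formulas) of classical first-order logic with identity. Semantics: a structure is $\mathcal{A}=\langle \mathcal{W},\{\mathcal{D}_w\}_{w\in\mathcal{W}}, I\rangle$ with $\mathcal{W}\neq\emptyset$ (worlds), nonempty domains $\mathcal{D}_w$, and $I(P^n_j,w)\subseteq \mathcal{D}_w^n$. A valuation is a function $v$ with $v(x,w)\in\mathcal{D}_w$ for every variable $x$ and world $w$; $v^a_x(w)$ denotes the valuation agreeing with $v$ everywhere except that it sends $x$ at world $w$ to $a\in\mathcal{D}_w$. Satisfaction: $\mathcal{A},v,w\models P^n_j(x_1,\dots,x_n)$ iff $\langle v(x_1,w),\dots,v(x_n,w)\rangle\in I(P^n_j,w)$; $\mathcal{A},v,w\models x=y$ iff $v(x,w)=v(y,w)$; $\neg,\to$ classical; $\mathcal{A},v,w\models\forall xA$ iff $\mathcal{A},v^a_x(w),w\models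 A$ for every $a\in\mathcal{D}_w$; $\mathcal{A},v,w\models\Box A$ iff $\mathcal{A},v',w'\models A$ for every valuation $v'$ on $\mathcal{A}$ and every $w'\in\mathcal{W}$. $\mathcal{A}\models A$ means $\mathcal{A},v,w\models A$ for all $v,w$. Let $\mathfrak{C}$ be the class of all such structures. A structure $\mathcal{A}\in\mathfrak{C}$ is universal if for every $\Box$-free formula $A$: $\mathcal{A}\models A$ implies $\mathcal{B}\models A$ for every $\mathcal{B}\in\mathfrak{C}$. $A$ is logically valid iff $\mathcal{A}\models A$ for every universal structure $\mathcal{A}$. Free variables and substitution: an occurrence of $x$ in $A$ is $\forall\Box$-bound if it is in the scope of a quantifier on $x$ or inside the scope of some $\Box$; otherwise it is $\forall\Box$-free. $x$ is a $\forall\Box$-free variable of $A$ if it has a $\forall\Box$-free occurrence. $A(^y/_x)$ (the $\forall\Box$-free substitution) is the simultaneous replacement of every $\forall\Box$-free occurrence of $x$ by $y$, provided $y$ is not captured by a quantifier at any replaced position. The system $\mathsf{FOL\Box}$ is the smallest set of formulas containing all instances of classical propositional tautologies and all instances of: (K) $\Box(A\to B)\to(\Box A\to\Box B)$; (T) $\Box A\to A$; (5) $\neg\Box A\to\Box\neg\Box A$; ($\forall1$) $\forall xA\to A(^y/_x)$ for an admissible $\forall\Box$-free substitution; ($\forall2$) $\forall x(A\to B)\to(A\to\forall xB)$ if $x$ is not a $\forall\Box$-free variable of $A$; (ID) $x=x$; (=) $x=y\wedge A(x)\to A(y)$ for $\Box$-free $A$ (the usual first-order identity axiom, replacing free occurrences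 of $x$ by $y$); (mix) $\Box A\to\forall xA$; (!) $\neg\Box A$ for every $\Box$-free formula $A\notin\mathsf{FOL}$; and closed under (RG) if $A\in\mathsf{FOL\Box}$ then $\Box A\in\mathsf{FOL\Box}$, and (MP) if $A\to B, A\in\mathsf{FOL\Box}$ then $B\in\mathsf{FOL\Box}$. -}

module Defs where

open import Level using (Level; 0ℓ) renaming (suc to lsuc)
open import Data.Nat using (ℕ; _≟_)
open import Data.Bool using (Bool; true; false; not; _∨_; if_then_else_)
open import Data.Vec using (Vec; map)
open import Data.Product using (Σ; _×_; _,_)
open import Data.Sum using (_⊎_)
open import Data.Empty using (⊥)
open import Data.Unit using (⊤)
open import Relation.Nullary using (¬_; yes; no; does)
open import Relation.Binary.PropositionalEquality using (_≡_; _≢_)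

-- Syntax of L(∀,□).  Variables are natural numbers; the predicate
-- symbol P^n_j is written  atom n j (x₁ ∷ … ∷ xₙ ∷ []).

Var : Set
Var = ℕ

infixr 5 _⇒_
infix 7 _≐_

data Formula : Set where
  atom : (n j : ℕ) → Vec Var n → Formula
  _≐_  : Var → Var → Formula
  ¬'   : Formula → Formula
  _⇒_  : Formula → Formula → Formula
  ∀'   : Var → Formula → Formula
  □    : Formula → Formula

_∨'_ : Formula → Formula → Formula
A ∨' B = ¬' A ⇒ B

_∧'_ : Formula → Formula → Formula
A ∧' B = ¬' (A ⇒ ¬' B)

∃' : Var → Formula → Formula
∃' x A = ¬' (∀' x (¬' A))

◇ : Formula → Formula
◇ A = ¬' (□ (¬' A))

data BoxFree : Formula → Set where
  bf-atom : ∀ {n j xs} → BoxFree (atom n j xs)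
  bf-eq   : ∀ {x y} → BoxFree (x ≐ y)
  bf-neg  : ∀ {A} → BoxFree A → BoxFree (¬' A)
  bf-imp  : ∀ {A B} → BoxFree A → BoxFree B → BoxFree (A ⇒ B)
  bf-all  : ∀ {x A} → BoxFree A → BoxFree (∀' x A)

_==_ : ℕ → ℕ → Bool
m == n = does (m ≟ n)

data _∈v_ (x : Var) : ∀ {n} → Vec Var n → Set where
  here  : ∀ {n} {xs : Vec Var n} → x ∈v (x Vec.∷ xs)
  there : ∀ {n y} {xs : Vec Var n} → x ∈v xs → x ∈v (y Vec.∷ xs)

FreeIn : Var → Formula → Set
FreeIn x (atom n j xs) = x ∈v xs
FreeIn x (a ≐ b)       = (x ≡ a) ⊎ (x ≡ b)
FreeIn x (¬' A)        = FreeIn x A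
FreeIn x (A ⇒ B)       = FreeIn x A ⊎ FreeIn x B
FreeIn x (∀' z A)      = (z ≢ x) × FreeIn x A
FreeIn x (□ A)         = ⊥

rn : Var → Var → Var → Var
rn y x z = if z == x then y else z

-- A(y/x): simultaneous replacement of every ∀□-free occurrence of x by y
sub : Var → Var → Formula → Formula
sub y x (atom n j xs) = atom n j (map (rn y x) xs)
sub y x (a ≐ b)       = rn y x a ≐ rn y x b
sub y x (¬' A)        = ¬' (sub y x A)
sub y x (A ⇒ B)       = sub y x A ⇒ sub y x B
sub y x (∀' z A)      = if z == x then ∀' z A else ∀' z (sub y x A)
sub y x (□ A)         = □ A

Substitutable : Var → Var → Formula → Set
Substitutable y x (atom n j xs) = ⊤
Substitutable y x (a ≐ b)       = ⊤
Substitutable y x (¬' A)        = Substitutable y x A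
Substitutable y x (A ⇒ B)       = Substitutable y x A × Substitutable y x B
Substitutable y x (∀' z A)      =
  (z ≢ x) → ((FreeIn x A → z ≢ y) × Substitutable y x A)
Substitutable y x (□ A)         = ⊤

data PForm : Set where
  pvar : ℕ → PForm
  pneg : PForm → PForm
  pimp : PForm → PForm → PForm

peval : (ℕ → Bool) → PForm → Bool
peval e (pvar i)   = e i
peval e (pneg φ)   = not (peval e φ)
peval e (pimp φ ψ) = not (peval e φ) ∨ peval e ψ

Tautology : PForm → Set
Tautology φ = (e : ℕ → Bool) → peval e φ ≡ true

inst : (ℕ → Formula) → PForm → Formula
inst σ (pvar i)   = σ i
inst σ (pneg φ)   = ¬' (inst σ φ)
inst σ (pimp φ ψ) = inst σ φ ⇒ inst σ ψ

TautInstance : Formula → Set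
TautInstance A = Σ PForm λ φ → Σ (ℕ → Formula) λ σ → Tautology φ × (inst σ φ ≡ A)

record FOModel : Set₁ where
  field
    Dom  : Set
    dom₀ : Dom
    Rel  : (n j : ℕ) → Vec Dom n → Set

updFO : {D : Set} → (Var → D) → Var → D → (Var → D)
updFO ρ x a z = if z == x then a else ρ z

foSat : (M : FOModel) → (Var → FOModel.Dom M) → (A : Formula) → BoxFree A → Set
foSat M ρ (atom n j xs) bf-atom = FOModel.Rel M n j (map ρ xs)
foSat M ρ (x ≐ y) bf-eq         = ρ x ≡ ρ y
foSat M ρ (¬' A) (bf-neg b)     = ¬ foSat M ρ A b
foSat M ρ (A ⇒ B) (bf-imp a b)  = foSat M ρ A a → foSat M ρ B b
foSat M ρ (∀' x A) (bf-all b)   = (a : FOModel.Dom M) → foSat M (updFO ρ x a) A b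

FOL : Formula → Set₁
FOL A = Σ (BoxFree A) λ b → (M : FOModel) (ρ : Var → FOModel.Dom M) → foSat M ρ A b

data FOL□ : Formula → Set₁ where
  ax-taut : ∀ {A} → TautInstance A → FOL□ A
  ax-K    : ∀ A B → FOL□ (□ (A ⇒ B) ⇒ (□ A ⇒ □ B))
  ax-T    : ∀ A → FOL□ (□ A ⇒ A)
  ax-5    : ∀ A → FOL□ (¬' (□ A) ⇒ □ (¬' (□ A)))
  ax-∀1   : ∀ x y A → Substitutable y x A → FOL□ (∀' x A ⇒ sub y x A)
  ax-∀2   : ∀ x A B → ¬ FreeIn x A → FOL□ (∀' x (A ⇒ B) ⇒ (A ⇒ ∀' x B))
  ax-ID   : ∀ x → FOL□ (x ≐ x)
  ax-=    : ∀ x y A → BoxFree A → Substitutable y x A →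
            FOL□ (((x ≐ y) ∧' A) ⇒ sub y x A)
  ax-mix  : ∀ x A → FOL□ (□ A ⇒ ∀' x A)
  ax-!    : ∀ A → BoxFree A → ¬ FOL A → FOL□ (¬' (□ A))
  rule-RG : ∀ {A} → FOL□ A → FOL□ (□ A)
  rule-MP : ∀ {A B} → FOL□ (A ⇒ B) → FOL□ A → FOL□ B

record Structure : Set₁ where
  field
    W   : Set
    w₀  : W
    D   : W → Set
    d₀  : (w : W) → D w
    I   : (n j : ℕ) → (w : W) → Vec (D w) n → Set

module _ (S : Structure) where
  open Structure S

  Valuation : Set
  Valuation = Var → (w : W) → D w

  -- v' is v^a_x(w): agrees with v except that it sends x at w to a
  IsVariant : Valuation → Var → (w : W) → D w → Valuation → Set
  IsVariant v x w a v' =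
    (v' x w ≡ a) ×
    ((y : Var) (w' : W) → ¬ ((y ≡ x) × (w' ≡ w)) → v' y w' ≡ v y w')

  Sat : Valuation → W → Formula → Set
  Sat v w (atom n j xs) = I n j w (map (λ x → v x w) xs)
  Sat v w (x ≐ y)       = v x w ≡ v y w
  Sat v w (¬' A)        = ¬ Sat v w A
  Sat v w (A ⇒ B)       = Sat v w A → Sat v w B
  Sat v w (∀' x A)      =
    (a : D w) (v' : Valuation) → IsVariant v x w a v' → Sat v' w A
  Sat v w (□ A)         = (v' : Valuation) (w' : W) → Sat v' w' A

  Models : Formula → Set
  Models A = (v : Valuation) (w : W) → Sat v w A

Universal : Structure → Set₁
Universal S = (A : Formula) → BoxFree A → Models S A → (B : Structure) → Models B A

LogicallyValid : Formula → Set₁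
LogicallyValid A = (S : Structure) → Universal S → Models S A

module Submission where

-- Since □ A quantifies over all valuations and all worlds, the truth of a formula at a world w
-- depends on the valuation only through its values at w.  Under this local semantics every axiom
-- becomes a direct check: T and mix hold because, with world equality
-- decided classically, every local assignment extends to a valuation; and (!) holds because a
-- universal structure validates a □-free formula only if every first-order model, read as a
-- one-world structure, does.

open import Defs
open import Level using (lift; lower) renaming (suc to lsuc; zero to lzero)
open import Axiom.ExcludedMiddle using (ExcludedMiddle)
open import Data.Nat using (_≟_)
open import Data.Bool using (if_then_else_)
open import Data.Bool.Properties using (if-float; if-cong-else)
open import Data.Vec using (Vec; map; []; _∷_)
open import Data.Vec.Properties using (map-∘; map-cong)
open import Data.Product using (_×_; _,_; proj₁; proj₂)
open import Data.Sum using (inj₁; inj₂)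
open import Data.Unit using (⊤; tt)
import Data.Unit.Properties as Unit
open import Data.Empty using (⊥-elim)
open import Function using (_∘_; _⇔_; mk⇔; Equivalence)
open import Function.Construct.Composition using (_⇔-∘_)
open import Function.Construct.Identity using (⇔-id)
open import Function.Related.TypeIsomorphisms using (→-cong-⇔; ¬-cong-⇔)
open import Relation.Binary.Definitions using (DecidableEquality)
open import Relation.Binary.PropositionalEquality
open import Relation.Nullary using (¬_; yes; no; does; proof)
open import Relation.Nullary.Decidable using (map′; decidable-stable; dec-true; dec-false)
open import Relation.Nullary.Reflects using (Reflects; invert; ¬-reflects; _→-reflects_)

open Equivalence using (to; from)

≡⇒⇔ : {P Q : Set} → P ≡ Q → P ⇔ Q
≡⇒⇔ refl = ⇔-id _

Π-cong-⇔ : {A : Set} {P Q : A → Set} → (∀ a → P a ⇔ Q a) → ((a : A) → P a) ⇔ ((a : A) → Q a)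
Π-cong-⇔ P⇔Q = mk⇔ (λ f a → to (P⇔Q a) (f a)) (λ g a → from (P⇔Q a) (g a))

lowerEM : ExcludedMiddle (lsuc lzero) → ExcludedMiddle lzero
lowerEM em = map′ lower lift em

updFO-same : ∀ {D : Set} (ρ : Var → D) x a → updFO ρ x a x ≡ a
updFO-same ρ x a = cong (λ b → if b then a else ρ x) (dec-true (x ≟ x) refl)

updFO-other : ∀ {D : Set} (ρ : Var → D) {x} a {z} → z ≢ x → updFO ρ x a z ≡ ρ z
updFO-other ρ {x} a {z} z≢x = cong (λ b → if b then a else ρ z) (dec-false (z ≟ x) z≢x)

updFO-fixed : ∀ {D : Set} (ρ : Var → D) {x a} → ρ x ≡ a → ∀ z → updFO ρ x a z ≡ ρ z
updFO-fixed ρ {x} {a} ρx≡a z with z ≟ x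
... | yes refl = trans (updFO-same ρ x a) (sym ρx≡a)
... | no z≢x   = updFO-other ρ a z≢x

updFO-shadow : ∀ {D : Set} (ρ : Var → D) x a b z → updFO (updFO ρ x b) x a z ≡ updFO ρ x a z
updFO-shadow ρ x a b z with z ≟ x
... | yes refl = trans (updFO-same (updFO ρ x b) x a) (sym (updFO-same ρ x a))
... | no z≢x   = begin
  updFO (updFO ρ x b) x a z  ≡⟨ updFO-other (updFO ρ x b) a z≢x ⟩
  updFO ρ x b z              ≡⟨ updFO-other ρ b z≢x ⟩
  ρ z                        ≡⟨ updFO-other ρ a z≢x ⟨
  updFO ρ x a z              ∎
  where open ≡-Reasoning

rn-updFO : {D : Set} (ρ : Var → D) (y x z : Var) → ρ (rn y x z) ≡ updFO ρ x (ρ y) z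
rn-updFO ρ y x z = if-float ρ (z == x)

sub-∀-bound : ∀ y x A → sub y x (∀' x A) ≡ ∀' x A
sub-∀-bound y x A = cong (λ b → if b then ∀' x A else ∀' x (sub y x A)) (dec-true (x ≟ x) refl)

sub-∀-free : ∀ y x {z} A → z ≢ x → sub y x (∀' z A) ≡ ∀' z (sub y x A)
sub-∀-free y x {z} A z≢x = cong (λ b → if b then ∀' z A else ∀' z (sub y x A)) (dec-false (z ≟ x) z≢x)

_≈[_]_ : {D : Set} → (Var → D) → Formula → (Var → D) → Set
ρ ≈[ A ] ρ′ = ∀ u → FreeIn u A → ρ u ≡ ρ′ u

map-cong-∈v : ∀ {D : Set} {n} {ρ ρ′ : Var → D} (xs : Vec Var n) →
              (∀ u → u ∈v xs → ρ u ≡ ρ′ u) → map ρ xs ≡ map ρ′ xs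
map-cong-∈v []       _    = refl
map-cong-∈v (x ∷ xs) ρ≈ρ′ = cong₂ _∷_ (ρ≈ρ′ x here) (map-cong-∈v xs (λ u → ρ≈ρ′ u ∘ there))

updFO-≈ : ∀ {D : Set} {ρ ρ′ : Var → D} {z} A (a : D) →
          ρ ≈[ ∀' z A ] ρ′ → updFO ρ z a ≈[ A ] updFO ρ′ z a
updFO-≈ {ρ = ρ} {ρ′} {z} A a ρ≈ρ′ u u∈A with u ≟ z
... | yes refl = trans (updFO-same ρ u a) (sym (updFO-same ρ′ u a))
... | no u≢z   = if-cong-else (u == z) (ρ≈ρ′ u (u≢z ∘ sym , u∈A))

module Local (S : Structure) where
  open Structure S

  _at_ : Valuation S → (w : W) → Var → D w
  (v at w) y = v y w

  Holds : (w : W) → (Var → D w) → Formula → Set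
  Holds w ρ (atom n j xs) = I n j w (map ρ xs)
  Holds w ρ (x ≐ y)       = ρ x ≡ ρ y
  Holds w ρ (¬' A)        = ¬ Holds w ρ A
  Holds w ρ (A ⇒ B)       = Holds w ρ A → Holds w ρ B
  Holds w ρ (∀' x A)      = (a : D w) → Holds w (updFO ρ x a) A
  Holds w ρ (□ A)         = (v : Valuation S) (w′ : W) → Holds w′ (v at w′) A

  Holds-coincidence : ∀ {w} A {ρ ρ′ : Var → D w} → ρ ≈[ A ] ρ′ → Holds w ρ A ⇔ Holds w ρ′ A
  Holds-coincidence {w} (atom n j xs) ρ≈ρ′ = ≡⇒⇔ (cong (I n j w) (map-cong-∈v xs ρ≈ρ′))
  Holds-coincidence (x ≐ y)  ρ≈ρ′ = ≡⇒⇔ (cong₂ _≡_ (ρ≈ρ′ x (inj₁ refl)) (ρ≈ρ′ y (inj₂ refl)))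
  Holds-coincidence (¬' A)   ρ≈ρ′ = ¬-cong-⇔ (Holds-coincidence A ρ≈ρ′)
  Holds-coincidence (A ⇒ B)  ρ≈ρ′ =
    →-cong-⇔ (Holds-coincidence A (λ u → ρ≈ρ′ u ∘ inj₁)) (Holds-coincidence B (λ u → ρ≈ρ′ u ∘ inj₂))
  Holds-coincidence (∀' z A) ρ≈ρ′ = Π-cong-⇔ λ a → Holds-coincidence A (updFO-≈ A a ρ≈ρ′)
  Holds-coincidence (□ A)    _    = ⇔-id _

  Holds-sub : ∀ {w y x} A → Substitutable y x A → (ρ : Var → D w) →
              Holds w ρ (sub y x A) ⇔ Holds w (updFO ρ x (ρ y)) A
  Holds-sub {w} {y} {x} (atom n j xs) _ ρ =
    ≡⇒⇔ (cong (I n j w) (trans (sym (map-∘ ρ (rn y x) xs)) (map-cong (rn-updFO ρ y x) xs)))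
  Holds-sub {y = y} {x} (a ≐ b) _ ρ = ≡⇒⇔ (cong₂ _≡_ (rn-updFO ρ y x a) (rn-updFO ρ y x b))
  Holds-sub (¬' A) s ρ = ¬-cong-⇔ (Holds-sub A s ρ)
  Holds-sub (A ⇒ B) (sA , sB) ρ = →-cong-⇔ (Holds-sub A sA ρ) (Holds-sub B sB ρ)
  Holds-sub {w} {y} {x} (∀' z A) s ρ with z ≟ x
  ... | yes refl =
    Π-cong-⇔ (λ a → Holds-coincidence A (λ u _ → sym (updFO-shadow ρ x a (ρ y) u)))
      ⇔-∘ ≡⇒⇔ (cong (Holds w ρ) (sub-∀-bound y x A))
  ... | no z≢x =
    Π-cong-⇔ (λ a → Holds-coincidence A (commute a) ⇔-∘ Holds-sub A s′ (updFO ρ z a))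
      ⇔-∘ ≡⇒⇔ (cong (Holds w ρ) (sub-∀-free y x A z≢x))
    where
    open ≡-Reasoning
    y-not-captured : FreeIn x A → z ≢ y
    y-not-captured = proj₁ (s z≢x)
    s′ : Substitutable y x A
    s′ = proj₂ (s z≢x)
    commute : ∀ a → updFO (updFO ρ z a) x (updFO ρ z a y) ≈[ A ] updFO (updFO ρ x (ρ y)) z a
    commute a u u∈A with u ≟ x
    ... | yes refl = begin
      updFO (updFO ρ z a) x (updFO ρ z a y) x  ≡⟨ updFO-same (updFO ρ z a) x _ ⟩
      updFO ρ z a y                            ≡⟨ updFO-other ρ a (y-not-captured u∈A ∘ sym) ⟩
      ρ y                                      ≡⟨ updFO-same ρ x (ρ y) ⟨
      updFO ρ x (ρ y) x                        ≡⟨ updFO-other (updFO ρ x (ρ y)) a (z≢x ∘ sym) ⟨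
      updFO (updFO ρ x (ρ y)) z a x            ∎
    ... | no u≢x   = trans (updFO-other (updFO ρ z a) _ u≢x)
                           (if-cong-else (u == z) (sym (updFO-other ρ (ρ y) u≢x)))
  Holds-sub (□ A) _ ρ = ⇔-id _

  inst-reflects : (em : ExcludedMiddle lzero) → ∀ {w} (ρ : Var → D w) σ φ →
                  Reflects (Holds w ρ (inst σ φ)) (peval (λ i → does (em {Holds w ρ (σ i)})) φ)
  inst-reflects em ρ σ (pvar i)   = proof em
  inst-reflects em ρ σ (pneg φ)   = ¬-reflects (inst-reflects em ρ σ φ)
  inst-reflects em ρ σ (pimp φ ψ) = inst-reflects em ρ σ φ →-reflects inst-reflects em ρ σ ψ

  Holds-taut : ExcludedMiddle lzero → ∀ {w} (ρ : Var → D w) σ φ → Tautology φ → Holds w ρ (inst σ φ)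
  Holds-taut em ρ σ φ taut = invert (subst (Reflects _) (taut _) (inst-reflects em ρ σ φ))

  module _ (_≟W_ : DecidableEquality W) where

    extend : (w : W) → (Var → D w) → Valuation S → Valuation S
    extend w ρ v y w′ with w′ ≟W w
    ... | yes refl = ρ y
    ... | no _     = v y w′

    extend-at : ∀ {w ρ v} y → extend w ρ v y w ≡ ρ y
    extend-at {w} y with w ≟W w
    ... | yes refl = refl
    ... | no w≢w   = ⊥-elim (w≢w refl)

    □⇒Holds : ∀ A → ((v : Valuation S) (w′ : W) → Holds w′ (v at w′) A) → ∀ w ρ → Holds w ρ A
    □⇒Holds A □A w ρ =
      to (Holds-coincidence A (λ u _ → extend-at u)) (□A (extend w ρ (λ _ → d₀)) w)

    variant : Valuation S → Var → (w : W) → D w → Valuation S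
    variant v x w a = extend w (updFO (v at w) x a) v

    variant-isVariant : ∀ v x w a → IsVariant S v x w a (variant v x w a)
    variant-isVariant v x w a = trans (extend-at x) (updFO-same (v at w) x a) , elsewhere
      where
      elsewhere : ∀ y w′ → ¬ (y ≡ x × w′ ≡ w) → variant v x w a y w′ ≡ v y w′
      elsewhere y w′ not-x-at-w with w′ ≟W w
      ... | yes refl = updFO-other (v at w) a (λ y≡x → not-x-at-w (y≡x , refl))
      ... | no _     = refl

    isVariant-at : ∀ {v x w a v′} → IsVariant S v x w a v′ → ∀ u → (v′ at w) u ≡ updFO (v at w) x a u
    isVariant-at {v} {x} {w} {a} (at-x , elsewhere) u with u ≟ x
    ... | yes refl = trans at-x (sym (updFO-same (v at w) x a))
    ... | no u≢x   = trans (elsewhere u w (u≢x ∘ proj₁)) (sym (updFO-other (v at w) a u≢x))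

    Sat⇔Holds : ∀ A v w → Sat S v w A ⇔ Holds w (v at w) A
    Sat⇔Holds (atom n j xs) v w = ⇔-id _
    Sat⇔Holds (x ≐ y)       v w = ⇔-id _
    Sat⇔Holds (¬' A)        v w = ¬-cong-⇔ (Sat⇔Holds A v w)
    Sat⇔Holds (A ⇒ B)       v w = →-cong-⇔ (Sat⇔Holds A v w) (Sat⇔Holds B v w)
    Sat⇔Holds (□ A)         v w = Π-cong-⇔ λ v′ → Π-cong-⇔ λ w′ → Sat⇔Holds A v′ w′
    Sat⇔Holds (∀' x A)      v w = mk⇔
      (λ h a → let v′ = variant v x w a; iv = variant-isVariant v x w a in
        to (Holds-coincidence A (λ u _ → isVariant-at iv u)) (to (Sat⇔Holds A v′ w) (h a v′ iv)))
      (λ h a v′ iv → from (Sat⇔Holds A v′ w) (from (Holds-coincidence A (λ u _ → isVariant-at iv u)) (h a)))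

foStructure : FOModel → Structure
foStructure M = record
  { W = ⊤ ; w₀ = tt ; D = λ _ → Dom ; d₀ = λ _ → dom₀ ; I = λ n j _ → Rel n j }
  where open FOModel M

Holds-foStructure : ∀ M A (bf : BoxFree A) ρ → Local.Holds (foStructure M) tt ρ A ⇔ foSat M ρ A bf
Holds-foStructure M _        bf-atom          ρ = ⇔-id _
Holds-foStructure M _        bf-eq            ρ = ⇔-id _
Holds-foStructure M (¬' A)   (bf-neg bf)      ρ = ¬-cong-⇔ (Holds-foStructure M A bf ρ)
Holds-foStructure M (A ⇒ B)  (bf-imp bfA bfB) ρ =
  →-cong-⇔ (Holds-foStructure M A bfA ρ) (Holds-foStructure M B bfB ρ)
Holds-foStructure M (∀' x A) (bf-all bf)      ρ = Π-cong-⇔ λ a → Holds-foStructure M A bf (updFO ρ x a)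

universal-Models⇒FOL : ∀ {S} → Universal S → ∀ {A} → BoxFree A → Models S A → FOL A
universal-Models⇒FOL U {A} bf ⊨A = bf , λ M ρ →
  to (Holds-foStructure M A bf ρ)
     (to (Local.Sat⇔Holds (foStructure M) Unit._≟_ A (λ y _ → ρ y) tt)
         (U A bf ⊨A (foStructure M) (λ y _ → ρ y) tt))

module Soundness (em : ExcludedMiddle lzero) (S : Structure) (U : Universal S) where
  open Structure S
  open Local S

  _≟W_ : DecidableEquality W
  _ ≟W _ = em

  sound : ∀ {A} → FOL□ A → ∀ w ρ → Holds w ρ A
  sound (ax-taut (φ , σ , taut , refl)) w ρ = Holds-taut em ρ σ φ taut
  sound (ax-K A B) w ρ □A⇒B □A v w′ = □A⇒B v w′ (□A v w′)
  sound (ax-T A) w ρ □A = □⇒Holds _≟W_ A □A w ρ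
  sound (ax-5 A) w ρ ¬□A _ _ = ¬□A
  sound (ax-∀1 x y A s) w ρ ∀A = from (Holds-sub A s ρ) (∀A (ρ y))
  sound (ax-∀2 x A B x∉A) w ρ ∀A⇒B hA a =
    ∀A⇒B a (to (Holds-coincidence A λ u u∈A → sym (updFO-other ρ {x} a λ { refl → x∉A u∈A })) hA)
  sound (ax-ID x) w ρ = refl
  sound (ax-= x y A _ s) w ρ x≐y∧A = decidable-stable em λ ¬A[y/x] →
    x≐y∧A λ ρx≡ρy hA → ¬A[y/x] (from (Holds-sub A s ρ)
      (to (Holds-coincidence A λ u _ → sym (updFO-fixed ρ ρx≡ρy u)) hA))
  sound (ax-mix x A) w ρ □A a = □⇒Holds _≟W_ A □A w (updFO ρ x a)
  sound (ax-! A bf ∉FOL) w ρ □A =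
    ∉FOL (universal-Models⇒FOL U bf λ v w′ → from (Sat⇔Holds _≟W_ A v w′) (□A v w′))
  sound (rule-RG ⊢A) w ρ v w′ = sound ⊢A w′ (v at w′)
  sound (rule-MP ⊢A⇒B ⊢A) w ρ = sound ⊢A⇒B w ρ (sound ⊢A w ρ)

theorem1 : ExcludedMiddle (lsuc lzero) → (A : Formula) → FOL□ A → LogicallyValid A
theorem1 em A ⊢A S U v w = from (Sat⇔Holds _≟W_ A v w) (sound ⊢A w (v at w))
  where
  open Local S
  open Soundness (lowerEM em) S U
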